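{- Let $m$ be a positive integer, $M=\{1,\dots,m\}$, and let $P$ be a finite poset on a set $K$ disjoint from $\{1,\dots,m+1\}$. Let $\mathcal{F}'(M,P)$ be the set of triples $(D,U,f)$ with $D\in\mathcal{D}(P)$, $U$ an upset of the subposet $P-DP$, and $f\in\mathcal{F}(M,P-D)$. For such a triple define $f_{m+1}:K\to\mathcal{P}_0(M\cup\{m+1\})$ by $f_{m+1}(x)=\{m+1\}$ if $x\in D$, $f_{m+1}(x)=f(x)\cup\{m+1\}$ if $x\in(U\cup DP)\setminus D$, and $f_{m+1}(x)=f(x)$ if $x\in K\setminus(U\cup DP)$. Then $(D,U,f)\mapsto f_{m+1}$ is a bijection from $\mathcal{F}'(M,P)$ onto $\mathcal{F}(\{1,\dots,m+1\},P)$. Consequently $$e(m+1,P)=\sum_{D\in\mathcal{D}(P)} d(P-DP)\,e(m,P-D)=\sum_{U\in\mathcal{U}(P)} d(U^\circ)\,e(m,U).$$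
   Context: For a poset $Q$ on a set $L$ and a finite set $N$, $\mathcal{F}(N,Q)$ is the set of maps $f:L\to\mathcal{P}_0(N)$ (nonempty subsets of $N$) with $x\le_Q y\Rightarrow f(x)\subseteq f(y)$. For $S\subseteq K$, $SP$ is the up-closure $\{y\mid \exists s\in S: s\le_P y\}$; $P-S$ is the subposet induced on $K\setminus S$. $\mathcal{D}(P)$, $\mathcal{U}(P)$ are the sets of downsets, upsets; $d(\cdot)$ counts downsets. For $U\subseteq K$, $U^\circ=K\setminus (K\setminus U)P$, and $d(U^\circ)$, $e(m,U)$ refer to the subposets of $P$ induced on $U^\circ$, $U$. For a finite poset $Q$ on $L$ and $|N|=n$ with $N\cap L=\emptyset$, $e(n,Q)$ is the number of partial orders on $N\cup L$ inducing $Q$ on $L$ whose set of minimal elements is exactly $N$. -}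

module Defs where

open import Data.Nat using (ℕ; zero; suc; _+_; _*_)
open import Data.Bool using (Bool; true; false; T)
open import Data.Bool.Properties using (T?) renaming (_≟_ to _≟ᵇ_)
open import Data.Fin using (Fin; _↑ˡ_; _↑ʳ_; fromℕ)
open import Data.Fin.Properties using (all?; any?) renaming (_≟_ to _≟ᶠ_)
open import Data.Fin.Subset using (Subset; _∈_; _∉_; _⊆_; Nonempty; ⁅_⁆; ∁)
open import Data.Fin.Subset.Properties using (_∈?_)
open import Data.Vec using (Vec; []; _∷_; tabulate; _∷ʳ_) renaming (lookup to vlookup)
open import Data.List using (List; []; _∷_; map; concatMap; filter; length; allFin) renaming (lookup to llookup)
open import Data.Product using (Σ; ∃; _×_; _,_)
open import Data.Sum using (_⊎_)
open import Relation.Nullary using (Dec; yes; no; ¬_; does)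
open import Relation.Nullary.Decidable using (_×-dec_; _→-dec_; _⊎-dec_; ¬?)
open import Relation.Binary.PropositionalEquality using (_≡_)

BRel : ℕ → Set
BRel k = Fin k → Fin k → Bool

IsPoset : ∀ {k} → BRel k → Set
IsPoset le =
  (∀ x → T (le x x)) ×
  (∀ x y → T (le x y) → T (le y x) → x ≡ y) ×
  (∀ x y z → T (le x y) → T (le y z) → T (le x z))

isPoset? : ∀ {k} (le : BRel k) → Dec (IsPoset le)
isPoset? le =
  all? (λ x → T? (le x x)) ×-dec
  (all? λ x → all? λ y → T? (le x y) →-dec T? (le y x) →-dec (x ≟ᶠ y)) ×-dec
  (all? λ x → all? λ y → all? λ z → T? (le x y) →-dec T? (le y z) →-dec T? (le x z))

IsDownset : ∀ {k} → BRel k → Subset k → Set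
IsDownset le D = ∀ x y → T (le x y) → y ∈ D → x ∈ D

isDownset? : ∀ {k} (le : BRel k) (D : Subset k) → Dec (IsDownset le D)
isDownset? le D = all? λ x → all? λ y → T? (le x y) →-dec (y ∈? D) →-dec (x ∈? D)

IsUpset : ∀ {k} → BRel k → Subset k → Set
IsUpset le U = ∀ x y → T (le x y) → x ∈ U → y ∈ U

isUpset? : ∀ {k} (le : BRel k) (U : Subset k) → Dec (IsUpset le U)
isUpset? le U = all? λ x → all? λ y → T? (le x y) →-dec (x ∈? U) →-dec (y ∈? U)

up : ∀ {k} → BRel k → Subset k → Subset k
up le S = tabulate λ y → does (any? λ s → (s ∈? S) ×-dec T? (le s y))

-- U is an upset of the induced subposet P - S  (on K ∖ S)
IsUpsetOfMinus : ∀ {k} → BRel k → Subset k → Subset k → Set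
IsUpsetOfMinus le S U =
  (∀ x → x ∈ U → x ∉ S) ×
  (∀ x y → x ∉ S → y ∉ S → T (le x y) → x ∈ U → y ∈ U)

InF : ∀ {k n} → BRel k → (Fin k → Subset n) → Set
InF le g = (∀ x → Nonempty (g x)) × (∀ x y → T (le x y) → g x ⊆ g y)

-- F'(M,P): triples (D, U, f) with D ∈ 𝒟(P), U ∈ 𝒰(P - DP), f ∈ F(M, P - D).
-- A map on K ∖ D is represented as a function taking a proof of x ∉ D.
record Triple {k} (m : ℕ) (le : BRel k) : Set where
  field
    D      : Subset k
    D-down : IsDownset le D
    U      : Subset k
    U-up   : IsUpsetOfMinus le (up le D) U
    f      : (x : Fin k) → x ∉ D → Subset m
    f-ne   : ∀ x (p : x ∉ D) → Nonempty (f x p)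
    f-mono : ∀ x y (p : x ∉ D) (q : y ∉ D) → T (le x y) → f x p ⊆ f y q

open Triple public

SameTriple : ∀ {k m} {le : BRel k} → Triple m le → Triple m le → Set
SameTriple t t' =
  D t ≡ D t' × U t ≡ U t' ×
  (∀ x (p : x ∉ D t) (p' : x ∉ D t') → f t x p ≡ f t' x p')

-- f_{m+1}.  In Subset (suc m), the elements of M = {1..m} are inject₁ i
-- (the first m positions) and m+1 is fromℕ m (the last position);
-- v ∷ʳ true = v ∪ {m+1},  v ∷ʳ false = v.
liftTriple : ∀ {k m} {le : BRel k} → Triple m le → Fin k → Subset (suc m)
liftTriple {m = m} {le} t x with x ∈? D t
... | yes _ = ⁅ fromℕ m ⁆
... | no p with (x ∈? U t) ⊎-dec (x ∈? up le (D t))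
...   | yes _ = f t x p ∷ʳ true
...   | no _  = f t x p ∷ʳ false

allVecs : ∀ {A : Set} → List A → (n : ℕ) → List (Vec A n)
allVecs xs zero = [] ∷ []
allVecs xs (suc n) = concatMap (λ a → map (a ∷_) (allVecs xs n)) xs

allSubsets : (n : ℕ) → List (Subset n)
allSubsets n = allVecs (true ∷ false ∷ []) n

-- induced subposet on S ⊆ K, re-indexed by Fin |S| (elements in increasing order)
elems : ∀ {k} → Subset k → List (Fin k)
elems {k} S = filter (_∈? S) (allFin k)

induced : ∀ {k} → BRel k → (S : Subset k) → BRel (length (elems S))
induced le S i j = le (llookup (elems S) i) (llookup (elems S) j)

d : ∀ {j} → BRel j → ℕ
d {j} q = length (filter (isDownset? q) (allSubsets j))

allRels : (N : ℕ) → List (Vec (Vec Bool N) N)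
allRels N = allVecs (allSubsets N) N

toRel : ∀ {N} → Vec (Vec Bool N) N → BRel N
toRel R x y = vlookup (vlookup R x) y

IsMinimal : ∀ {N} → BRel N → Fin N → Set
IsMinimal r z = ∀ w → T (r w z) → w ≡ z

isMinimal? : ∀ {N} (r : BRel N) (z : Fin N) → Dec (IsMinimal r z)
isMinimal? r z = all? λ w → T? (r w z) →-dec (w ≟ᶠ z)

-- Partial orders on N ∪ L, where N = Fin n ↪ Fin (n + j) via _↑ˡ j
-- and L = Fin j ↪ Fin (n + j) via n ↑ʳ_, inducing q on L,
-- whose set of minimal elements is exactly N.
IsExtension : (n : ℕ) {j : ℕ} → BRel j → BRel (n + j) → Set
IsExtension n {j} q r =
  IsPoset r ×
  (∀ a b → r (n ↑ʳ a) (n ↑ʳ b) ≡ q a b) ×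
  (∀ i → IsMinimal r (i ↑ˡ j)) ×
  (∀ a → ¬ IsMinimal r (n ↑ʳ a))

isExtension? : (n : ℕ) {j : ℕ} (q : BRel j) (r : BRel (n + j)) → Dec (IsExtension n q r)
isExtension? n {j} q r =
  isPoset? r ×-dec
  (all? λ a → all? λ b → r (n ↑ʳ a) (n ↑ʳ b) ≟ᵇ q a b) ×-dec
  (all? λ i → isMinimal? r (i ↑ˡ j)) ×-dec
  (all? λ a → ¬? (isMinimal? r (n ↑ʳ a)))

e : (n : ℕ) {j : ℕ} → BRel j → ℕ
e n {j} q = length (filter (λ R → isExtension? n q (toRel R)) (allRels (n + j)))

downsets : ∀ {k} → BRel k → List (Subset k)
downsets {k} le = filter (isDownset? le) (allSubsets k)

upsets : ∀ {k} → BRel k → List (Subset k)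
upsets {k} le = filter (isUpset? le) (allSubsets k)

-- Write g ∈ F({1,…,m+1}, P) as g x = h x ∪ (if b x then {m+1} else ∅) with h x ⊆ M.  Then g is
-- order preserving iff h and b are, and g x ≠ ∅ iff h x ≠ ∅ or b x.  Hence D = {x | g x = {m+1}}
-- is a downset on which h vanishes and b holds; off D, h is an element of F(M, P − D), and b is
-- forced on DP while on P − DP it is the indicator of an arbitrary upset U.  This is the bijection
-- (D, U, f) ↦ f_{m+1}.  For the counts, an extension of Q by the minimal elements N corresponds to
-- the map a ↦ {i ∈ N | i ≤ a} in F(N, Q), nonempty because every element lies above a minimal
-- one; so e(n, Q) = |F(n, Q)|, grouping F({1,…,m+1}, P) by D gives the first formula, and
-- complementation exchanges downsets and upsets for the second.

module Submission where

open import Defs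
open import Level using (Level)
open import Data.Bool using (Bool; true; false; T; not; if_then_else_)
open import Data.Bool.Properties using (T?; not-involutive) renaming (_≟_ to _≟ᵇ_)
open import Data.Empty using (⊥-elim)
open import Data.Fin using (Fin; fromℕ; inject₁; _↑ˡ_; _↑ʳ_; splitAt) renaming (zero to fzero; suc to fsuc)
open import Data.Fin.Induction using (po-wellFounded)
open import Data.Fin.Properties
  using (all?; any?; ¬∀⟶∃¬; splitAt-↑ˡ; splitAt-↑ʳ; join-splitAt; ↑ˡ-injective) renaming (_≟_ to _≟ᶠ_)
open import Data.Fin.Subset using (Subset; _∈_; _∉_; _⊆_; Nonempty; ⁅_⁆; ⊥; ∁)
open import Data.Fin.Subset.Properties
  using (_∈?_; _⊆?_; nonempty?; Empty-unique; ∉⊥; ⊥⊆; x∈⁅x⁆; x∈⁅y⁆⇒x≡y; ⊆-antisym;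
         x∉p⇒x∈∁p; x∈∁p⇒x∉p)
open import Data.List
  using (List; []; _∷_; _++_; map; concatMap; filter; length; allFin; cartesianProduct; cartesianProductWith)
  renaming (lookup to lookupₗ)
open import Data.List.Properties using (map-++; map-∘; map-cong; map-cong-local; length-map; filter-none)
open import Data.List.Membership.Propositional using () renaming (_∈_ to _∈ₗ_)
open import Data.List.Membership.Propositional.Properties
  using (∈-filter⁺; ∈-filter⁻; ∈-map⁺; ∈-map⁻; ∈-cartesianProductWith⁺; ∈-cartesianProduct⁺;
         ∈-lookup; ∈-allFin)
open import Data.List.Membership.Propositional.Properties.WithK using (unique∧set⇒bag)
open import Data.List.Relation.Binary.BagAndSetEquality using (∼bag⇒↭)
open import Data.List.Relation.Binary.Permutation.Propositional using (_↭_)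
import Data.List.Relation.Binary.Permutation.Propositional.Properties as ↭
open import Data.List.Relation.Unary.All as All using (All; []; _∷_)
open import Data.List.Relation.Unary.AllPairs using ([]; _∷_)
open import Data.List.Relation.Unary.Any using (here; there; index)
open import Data.List.Relation.Unary.Any.Properties using (lookup-index)
open import Data.List.Relation.Unary.Unique.Propositional using (Unique)
import Data.List.Relation.Unary.Unique.Propositional.Properties as Unique
open import Data.Nat using (ℕ; zero; suc; _+_; _*_; _≤_)
open import Data.Nat.ListAction using (sum)
open import Data.Nat.ListAction.Properties using (sum-++; sum-↭)
open import Data.Nat.Properties using (+-commutativeSemigroup; *-zeroʳ; *-distribˡ-+; *-distribʳ-+)
open import Algebra.Properties.CommutativeSemigroup +-commutativeSemigroup using (interchange)
open import Data.Product using (Σ; ∃; _×_; _,_; proj₁; proj₂)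
open import Data.Sum using (_⊎_; inj₁; inj₂)
open import Data.Unit using (tt)
open import Data.Vec using (Vec; []; _∷_; _∷ʳ_; tabulate; lookup; init; last; initLast)
open import Data.Vec.Properties
  using (∷-injective; ≡-dec; lookup∘tabulate; tabulate∘lookup; tabulate-cong; []=⇒lookup; lookup⇒[]=;
         init-∷ʳ; last-∷ʳ; ∷ʳ-injectiveˡ)
  renaming (map-∘ to mapᵥ-∘; map-cong to mapᵥ-cong; map-id to mapᵥ-id)
open import Function using (_∘_)
open import Function.Bundles using (mk⇔)
open import Induction.WellFounded using (Acc; acc)
open import Relation.Unary using (Pred; Decidable)
open import Relation.Nullary using (Dec; yes; no; ¬_; does; contradiction)
open import Relation.Nullary.Decidable using (_×-dec_; _⊎-dec_; _→-dec_; ¬?; decidable-stable)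
open import Relation.Binary.Definitions using (DecidableEquality)
open import Relation.Binary.Structures using (IsPartialOrder)
open import Relation.Binary.PropositionalEquality
  using (_≡_; _≢_; refl; sym; trans; cong; cong₂; subst; subst₂; isEquivalence; module ≡-Reasoning)

private
  variable
    a b p q : Level
    A : Set a
    B : Set b

T-does⁺ : (A? : Dec A) → A → T (does A?)
T-does⁺ (yes _) _  = tt
T-does⁺ (no ¬a) a = ¬a a

T-does⁻ : (A? : Dec A) → T (does A?) → A
T-does⁻ (yes a) _ = a

T-ext : ∀ {b b′} → (T b → T b′) → (T b′ → T b) → b ≡ b′
T-ext {false} {false} _ _ = refl
T-ext {false} {true}  _ f = ⊥-elim (f tt)
T-ext {true}  {false} t _ = ⊥-elim (t tt)
T-ext {true}  {true}  _ _ = refl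

T-not-contra : ∀ {b b′} → (T b′ → T b) → T (not b) → T (not b′)
T-not-contra {b′ = false} _ _     = tt
T-not-contra {false} {true} b′⇒b _ = b′⇒b tt
T-not-contra {true}  {true} _    ()

∈⇒T-lookup : ∀ {n} {s : Subset n} {i} → i ∈ s → T (lookup s i)
∈⇒T-lookup i∈s = subst T (sym ([]=⇒lookup i∈s)) tt

T-lookup⇒∈ : ∀ {n} {s : Subset n} {i} → T (lookup s i) → i ∈ s
T-lookup⇒∈ {s = s} {i} t with lookup s i in eq
... | true = lookup⇒[]= i s eq

∈-tabulate⁺ : ∀ {n} (f : Fin n → Bool) {i} → T (f i) → i ∈ tabulate f
∈-tabulate⁺ f {i} t = T-lookup⇒∈ (subst T (sym (lookup∘tabulate f i)) t)

∈-tabulate⁻ : ∀ {n} (f : Fin n → Bool) {i} → i ∈ tabulate f → T (f i)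
∈-tabulate⁻ f {i} i∈ = subst T (lookup∘tabulate f i) (∈⇒T-lookup i∈)

∈-tabulate-does⁺ : ∀ {n} {P : Pred (Fin n) p} (P? : Decidable P) {i} → P i → i ∈ tabulate (does ∘ P?)
∈-tabulate-does⁺ P? {i} = ∈-tabulate⁺ (does ∘ P?) ∘ T-does⁺ (P? i)

∈-tabulate-does⁻ : ∀ {n} {P : Pred (Fin n) p} (P? : Decidable P) {i} → i ∈ tabulate (does ∘ P?) → P i
∈-tabulate-does⁻ P? {i} = T-does⁻ (P? i) ∘ ∈-tabulate⁻ (does ∘ P?)

indicator : ∀ {P : Set p} → Dec P → ℕ
indicator P? = if does P? then 1 else 0

indicator-×-dec : ∀ {P : Set p} {Q : Set q} (P? : Dec P) (Q? : Dec Q) →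
  indicator (P? ×-dec Q?) ≡ indicator P? * indicator Q?
indicator-×-dec (yes _) (yes _) = refl
indicator-×-dec (yes _) (no _)  = refl
indicator-×-dec (no _)  _       = refl

length-filter≡sum-indicator : ∀ {P : Pred A p} (P? : Decidable P) (xs : List A) →
  length (filter P? xs) ≡ sum (map (indicator ∘ P?) xs)
length-filter≡sum-indicator P? [] = refl
length-filter≡sum-indicator P? (x ∷ xs) with P? x
... | yes _ = cong suc (length-filter≡sum-indicator P? xs)
... | no _  = length-filter≡sum-indicator P? xs

sum-map-zero : (xs : List A) → sum (map (λ _ → 0) xs) ≡ 0
sum-map-zero []       = refl
sum-map-zero (_ ∷ xs) = sum-map-zero xs

sum-map-+ : (f g : A → ℕ) (xs : List A) →
  sum (map (λ x → f x + g x) xs) ≡ sum (map f xs) + sum (map g xs)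
sum-map-+ f g [] = refl
sum-map-+ f g (x ∷ xs) = trans (cong (f x + g x +_) (sum-map-+ f g xs)) (interchange (f x) (g x) _ _)

sum-map-* : (c : ℕ) (f : A → ℕ) (xs : List A) → sum (map (λ x → c * f x) xs) ≡ c * sum (map f xs)
sum-map-* c f []       = sym (*-zeroʳ c)
sum-map-* c f (x ∷ xs) = trans (cong (c * f x +_) (sum-map-* c f xs)) (sym (*-distribˡ-+ c (f x) _))

sum-map-swap : (f : A → B → ℕ) (xs : List A) (ys : List B) →
  sum (map (λ x → sum (map (f x) ys)) xs) ≡ sum (map (λ y → sum (map (λ x → f x y) xs)) ys)
sum-map-swap f []       ys = sym (sum-map-zero ys)
sum-map-swap f (x ∷ xs) ys =
  trans (cong (sum (map (f x) ys) +_) (sum-map-swap f xs ys)) (sym (sum-map-+ (f x) _ ys))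

sum-map-filter : ∀ {P : Pred A p} (P? : Decidable P) (f : A → ℕ) (xs : List A) →
  (∀ x → ¬ P x → f x ≡ 0) → sum (map f xs) ≡ sum (map f (filter P? xs))
sum-map-filter P? f [] _ = refl
sum-map-filter P? f (x ∷ xs) f≡0 with P? x
... | yes _ = cong (f x +_) (sum-map-filter P? f xs f≡0)
... | no ¬px = trans (cong (_+ sum (map f xs)) (f≡0 x ¬px)) (sum-map-filter P? f xs f≡0)


module _ (_≟_ : DecidableEquality A) {x : A} where

  sum-map-indicator-≢ : ∀ {xs} → All (x ≢_) xs → sum (map (λ y → indicator (x ≟ y)) xs) ≡ 0
  sum-map-indicator-≢ [] = refl
  sum-map-indicator-≢ {y ∷ _} (x≢y ∷ x≢ys) with x ≟ y
  ... | yes x≡y = contradiction x≡y x≢y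
  ... | no _    = sum-map-indicator-≢ x≢ys

  sum-map-indicator-∈ : ∀ {xs} → Unique xs → x ∈ₗ xs → sum (map (λ y → indicator (x ≟ y)) xs) ≡ 1
  sum-map-indicator-∈ {y ∷ _} (y∉ys ∷ _) _ with x ≟ y
  sum-map-indicator-∈ (y∉ys ∷ _) _          | yes refl = cong suc (sum-map-indicator-≢ y∉ys)
  sum-map-indicator-∈ _           (here x≡y)  | no x≢y   = contradiction x≡y x≢y
  sum-map-indicator-∈ (_ ∷ u)     (there x∈)  | no _     = sum-map-indicator-∈ u x∈

record Enumeration (A : Set a) : Set a where
  field
    list     : List A
    unique   : Unique list
    complete : ∀ x → x ∈ₗ list

open Enumeration public

bools : Enumeration Bool
bools = record { list = true ∷ false ∷ [] ; unique = ((λ ()) ∷ []) ∷ [] ∷ [] ; complete = complete′ }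
  where
  complete′ : ∀ x → x ∈ₗ true ∷ false ∷ []
  complete′ true  = here refl
  complete′ false = there (here refl)

allVecs-suc : {A : Set} (xs : List A) (n : ℕ) → allVecs xs (suc n) ≡ cartesianProductWith _∷_ xs (allVecs xs n)
allVecs-suc []       n = refl
allVecs-suc (x ∷ xs) n = cong (map (x ∷_) (allVecs (x ∷ xs) n) ++_) (go xs)
  where
  go : ∀ ys → concatMap (λ y → map (y ∷_) (allVecs (x ∷ xs) n)) ys
            ≡ cartesianProductWith _∷_ ys (allVecs (x ∷ xs) n)
  go []       = refl
  go (y ∷ ys) = cong (map (y ∷_) (allVecs (x ∷ xs) n) ++_) (go ys)

vectors : {A : Set} → Enumeration A → (n : ℕ) → Enumeration (Vec A n)
vectors E n = record { list = allVecs (list E) n ; unique = unique′ n ; complete = complete′ n }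
  where
  unique′ : ∀ n → Unique (allVecs (list E) n)
  unique′ zero    = [] ∷ []
  unique′ (suc n) = subst Unique (sym (allVecs-suc (list E) n))
    (Unique.cartesianProductWith⁺ _∷_ ∷-injective (unique E) (unique′ n))
  complete′ : ∀ n (v : Vec _ n) → v ∈ₗ allVecs (list E) n
  complete′ zero    []       = here refl
  complete′ (suc n) (x ∷ v) = subst (x ∷ v ∈ₗ_) (sym (allVecs-suc (list E) n))
    (∈-cartesianProductWith⁺ _∷_ (complete E x) (complete′ n v))

pairs : Enumeration A → Enumeration B → Enumeration (A × B)
pairs EA EB = record
  { list     = cartesianProduct (list EA) (list EB)
  ; unique   = Unique.cartesianProduct⁺ (unique EA) (unique EB)
  ; complete = λ (x , y) → ∈-cartesianProduct⁺ (complete EA x) (complete EB y)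
  }

length-filter-partition : ∀ {k} {K : Set k} {P : Pred A p} (keys : Enumeration K)
  (_≟_ : DecidableEquality K) (key : A → K) (P? : Decidable P) (xs : List A) →
  length (filter P? xs) ≡ sum (map (λ c → length (filter (λ x → P? x ×-dec (key x ≟ c)) xs)) (list keys))
length-filter-partition keys _≟_ key P? xs = begin
  length (filter P? xs)
    ≡⟨ length-filter≡sum-indicator P? xs ⟩
  sum (map (indicator ∘ P?) xs)
    ≡⟨ cong sum (map-cong split xs) ⟩
  sum (map (λ x → sum (map (λ c → indicator (P? x ×-dec (key x ≟ c))) (list keys))) xs)
    ≡⟨ sum-map-swap _ xs (list keys) ⟩
  sum (map (λ c → sum (map (λ x → indicator (P? x ×-dec (key x ≟ c))) xs)) (list keys))
    ≡⟨ cong sum (map-cong (λ c → sym (length-filter≡sum-indicator _ xs)) (list keys)) ⟩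
  sum (map (λ c → length (filter (λ x → P? x ×-dec (key x ≟ c)) xs)) (list keys))
    ∎
  where
  open ≡-Reasoning
  split : ∀ x → indicator (P? x) ≡ sum (map (λ c → indicator (P? x ×-dec (key x ≟ c))) (list keys))
  split x with P? x
  ... | yes _ = sym (sum-map-indicator-∈ _≟_ (unique keys) (complete keys (key x)))
  ... | no _  = sym (sum-map-zero (list keys))

length-filter-cartesianProduct : ∀ {P : Pred A p} {Q : Pred B q} (P? : Decidable P) (Q? : Decidable Q)
  (xs : List A) (ys : List B) →
  length (filter (λ z → P? (proj₁ z) ×-dec Q? (proj₂ z)) (cartesianProduct xs ys))
    ≡ length (filter P? xs) * length (filter Q? ys)
length-filter-cartesianProduct {A = A} {B = B} P? Q? xs ys = begin
  length (filter R? (cartesianProduct xs ys))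
    ≡⟨ length-filter≡sum-indicator R? (cartesianProduct xs ys) ⟩
  sum (map (indicator ∘ R?) (cartesianProduct xs ys))
    ≡⟨ sum-cartesianProduct xs ⟩
  sum (map (indicator ∘ P?) xs) * sum (map (indicator ∘ Q?) ys)
    ≡⟨ sym (cong₂ _*_ (length-filter≡sum-indicator P? xs) (length-filter≡sum-indicator Q? ys)) ⟩
  length (filter P? xs) * length (filter Q? ys)
    ∎
  where
  open ≡-Reasoning
  R? = λ (z : A × B) → P? (proj₁ z) ×-dec Q? (proj₂ z)
  Σys = sum (map (indicator ∘ Q?) ys)

  row : ∀ x → sum (map (indicator ∘ R?) (map (x ,_) ys)) ≡ indicator (P? x) * Σys
  row x = begin
    sum (map (indicator ∘ R?) (map (x ,_) ys))
      ≡⟨ cong sum (map-∘ ys) ⟨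
    sum (map (λ y → indicator (P? x ×-dec Q? y)) ys)
      ≡⟨ cong sum (map-cong (λ y → indicator-×-dec (P? x) (Q? y)) ys) ⟩
    sum (map (λ y → indicator (P? x) * indicator (Q? y)) ys)
      ≡⟨ sum-map-* (indicator (P? x)) (indicator ∘ Q?) ys ⟩
    indicator (P? x) * Σys
      ∎

  sum-cartesianProduct : ∀ xs → sum (map (indicator ∘ R?) (cartesianProduct xs ys))
                              ≡ sum (map (indicator ∘ P?) xs) * Σys
  sum-cartesianProduct [] = refl
  sum-cartesianProduct (x ∷ xs) = begin
    sum (map (indicator ∘ R?) (map (x ,_) ys ++ cartesianProduct xs ys))
      ≡⟨ cong sum (map-++ _ (map (x ,_) ys) _) ⟩
    sum (map (indicator ∘ R?) (map (x ,_) ys) ++ map (indicator ∘ R?) (cartesianProduct xs ys))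
      ≡⟨ sum-++ (map (indicator ∘ R?) (map (x ,_) ys)) _ ⟩
    sum (map (indicator ∘ R?) (map (x ,_) ys)) + sum (map (indicator ∘ R?) (cartesianProduct xs ys))
      ≡⟨ cong₂ _+_ (row x) (sum-cartesianProduct xs) ⟩
    indicator (P? x) * Σys + sum (map (indicator ∘ P?) xs) * Σys
      ≡⟨ *-distribʳ-+ Σys (indicator (P? x)) (sum (map (indicator ∘ P?) xs)) ⟨
    sum (map (indicator ∘ P?) (x ∷ xs)) * Σys
      ∎

Unique-map⁺-onAll : ∀ {P : Pred A p} (f : A → B) → (∀ {x y} → P x → P y → f x ≡ f y → x ≡ y) →
  ∀ {xs} → All P xs → Unique xs → Unique (map f xs)
Unique-map⁺-onAll f inj [] [] = []
Unique-map⁺-onAll {P = P} f inj (px ∷ pxs) (x∉xs ∷ u) = fresh px pxs x∉xs ∷ Unique-map⁺-onAll f inj pxs u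
  where
  fresh : ∀ {x ys} → P x → All P ys → All (x ≢_) ys → All (f x ≢_) (map f ys)
  fresh px []         []           = []
  fresh px (py ∷ pys) (x≢y ∷ x≢ys) = (x≢y ∘ inj px py) ∷ fresh px pys x≢ys

module _ {P : Pred A p} {Q : Pred B q} (EA : Enumeration A) (EB : Enumeration B)
         (P? : Decidable P) (Q? : Decidable Q) (to : A → B) (from : B → A)
         (to-Q : ∀ {x} → P x → Q (to x)) (from-P : ∀ {y} → Q y → P (from y))
         (from∘to : ∀ {x} → P x → from (to x) ≡ x) (to∘from : ∀ {y} → Q y → to (from y) ≡ y) where

  private
    Ps = filter P? (list EA)
    Qs = filter Q? (list EB)

  map-filter-↭ : map to Ps ↭ Qs
  map-filter-↭ = ∼bag⇒↭ (unique∧set⇒bag unique-image (Unique.filter⁺ Q? (unique EB)) (mk⇔ image⊆ ⊆image))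
    where
    unique-image : Unique (map to Ps)
    unique-image = Unique-map⁺-onAll to
      (λ px py e → trans (sym (from∘to px)) (trans (cong from e) (from∘to py)))
      (All.tabulate (λ x∈ → proj₂ (∈-filter⁻ P? {xs = list EA} x∈))) (Unique.filter⁺ P? (unique EA))
    image⊆ : ∀ {y} → y ∈ₗ map to Ps → y ∈ₗ Qs
    image⊆ y∈ with ∈-map⁻ to y∈
    ... | x , x∈ , refl = ∈-filter⁺ Q? (complete EB (to x)) (to-Q (proj₂ (∈-filter⁻ P? {xs = list EA} x∈)))
    ⊆image : ∀ {y} → y ∈ₗ Qs → y ∈ₗ map to Ps
    ⊆image {y} y∈ = subst (_∈ₗ map to Ps) (to∘from qy)
      (∈-map⁺ to (∈-filter⁺ P? (complete EA (from y)) (from-P qy)))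
      where qy = proj₂ (∈-filter⁻ Q? {xs = list EB} y∈)

  length-filter-bijection : length Ps ≡ length Qs
  length-filter-bijection = trans (sym (length-map to Ps)) (↭.↭-length map-filter-↭)

  sum-filter-bijection : (w : A → ℕ) (w′ : B → ℕ) → (∀ {x} → P x → w x ≡ w′ (to x)) →
    sum (map w Ps) ≡ sum (map w′ Qs)
  sum-filter-bijection w w′ w≡w′∘to = begin
    sum (map w Ps)
      ≡⟨ cong sum (map-cong-local (All.tabulate λ x∈ → w≡w′∘to (proj₂ (∈-filter⁻ P? {xs = list EA} x∈)))) ⟩
    sum (map (w′ ∘ to) Ps)
      ≡⟨ cong sum (map-∘ Ps) ⟩
    sum (map w′ (map to Ps))
      ≡⟨ sum-↭ (↭.map⁺ w′ map-filter-↭) ⟩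
    sum (map w′ Qs)
      ∎
    where open ≡-Reasoning

-- Extensions by minimal elements and order-preserving maps

InF? : ∀ {j n} (q : BRel j) (g : Fin j → Subset n) → Dec (InF q g)
InF? q g = all? (λ x → nonempty? (g x)) ×-dec (all? λ x → all? λ y → T? (q x y) →-dec (g x ⊆? g y))

InF-cong : ∀ {j n} {q : BRel j} {g g′ : Fin j → Subset n} → (∀ x → g x ≡ g′ x) → InF q g → InF q g′
InF-cong g≗g′ (g-ne , g-mono) =
  (λ x → subst Nonempty (g≗g′ x) (g-ne x)) ,
  (λ x y x≤y → subst (_ ⊆_) (g≗g′ y) (subst (_⊆ _) (g≗g′ x) (g-mono x y x≤y)))

countF : (n : ℕ) {j : ℕ} → BRel j → ℕ
countF n {j} q = length (filter (InF? q ∘ lookup) (allVecs (allSubsets n) j))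

minimal-below : ∀ {N} (r : BRel N) → IsPoset r → ∀ z → ∃ λ w → T (r w z) × IsMinimal r w
minimal-below {N} r (r-refl , r-antisym , r-trans) z = go z (po-wellFounded isPartialOrder z)
  where
  isPartialOrder : IsPartialOrder _≡_ (λ x y → T (r x y))
  isPartialOrder = record
    { isPreorder = record
      { isEquivalence = isEquivalence
      ; reflexive     = λ { {x} refl → r-refl x }
      ; trans         = r-trans _ _ _
      }
    ; antisym = r-antisym _ _
    }

  go : ∀ z → Acc _ z → ∃ λ w → T (r w z) × IsMinimal r w
  go z (acc smaller) with isMinimal? r z
  ... | yes z-min = z , r-refl z , z-min
  ... | no ¬z-min with ¬∀⟶∃¬ N _ (λ w → T? (r w z) →-dec (w ≟ᶠ z)) ¬z-min
  ... | w , ¬[w≤z⇒w≡z] = descend (go w (smaller (w≤z , w≢z)))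
    where
    w≤z : T (r w z)
    w≤z = decidable-stable (T? (r w z)) (λ w≰z → ¬[w≤z⇒w≡z] (⊥-elim ∘ w≰z))
    w≢z : w ≢ z
    w≢z w≡z = ¬[w≤z⇒w≡z] (λ _ → w≡z)
    descend : (∃ λ v → T (r v w) × IsMinimal r v) → ∃ λ v → T (r v z) × IsMinimal r v
    descend (v , v≤w , v-min) = v , r-trans v w z v≤w w≤z , v-min

data SplitView (n j : ℕ) : Fin (n + j) → Set where
  inN : (i : Fin n) → SplitView n j (i ↑ˡ j)
  inL : (a : Fin j) → SplitView n j (n ↑ʳ a)

splitView : ∀ n j x → SplitView n j x
splitView n j x with splitAt n x | join-splitAt n j x
... | inj₁ i | refl = inN i
... | inj₂ a | refl = inL a

↑ˡ≢↑ʳ : ∀ {n j} (i : Fin n) (a : Fin j) → i ↑ˡ j ≢ n ↑ʳ a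
↑ˡ≢↑ʳ {n} {j} i a eq with trans (sym (splitAt-↑ˡ n i j)) (trans (cong (splitAt n) eq) (splitAt-↑ʳ n j a))
... | ()

IsExtension-cong : ∀ n {j} {q : BRel j} {r r′ : BRel (n + j)} → (∀ x y → r x y ≡ r′ x y) →
  IsExtension n q r → IsExtension n q r′
IsExtension-cong n {j} {r = r} {r′} r≐r′ ((r-refl , r-antisym , r-trans) , r-restricts , N-min , L-nonmin) =
  (refl′ , antisym′ , trans′) , (λ a b → trans (sym (r≐r′ _ _)) (r-restricts a b)) ,
  (λ i w → N-min i w ∘ from) , (λ a a-min → L-nonmin a (λ w → a-min w ∘ to))
  where
  to : ∀ {x y} → T (r x y) → T (r′ x y)
  to {x} {y} = subst T (r≐r′ x y)
  from : ∀ {x y} → T (r′ x y) → T (r x y)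
  from {x} {y} = subst T (sym (r≐r′ x y))
  refl′ = λ x → to (r-refl x)
  antisym′ = λ x y p q → r-antisym x y (from p) (from q)
  trans′ = λ x y z p q → to (r-trans x y z (from p) (from q))

module Adjoin (n : ℕ) {j : ℕ} (q : BRel j) where

  adjoinSum : (Fin j → Subset n) → Fin n ⊎ Fin j → Fin n ⊎ Fin j → Bool
  adjoinSum g (inj₁ i) (inj₁ i′) = does (i ≟ᶠ i′)
  adjoinSum g (inj₁ i) (inj₂ a)  = lookup (g a) i
  adjoinSum g (inj₂ _) (inj₁ _)  = false
  adjoinSum g (inj₂ a) (inj₂ b)  = q a b

  adjoin : (Fin j → Subset n) → BRel (n + j)
  adjoin g x y = adjoinSum g (splitAt n x) (splitAt n y)

  module _ (g : Fin j → Subset n) where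

    adjoin-↑ˡ-↑ˡ : ∀ i i′ → adjoin g (i ↑ˡ j) (i′ ↑ˡ j) ≡ does (i ≟ᶠ i′)
    adjoin-↑ˡ-↑ˡ i i′ rewrite splitAt-↑ˡ n i j | splitAt-↑ˡ n i′ j = refl

    adjoin-↑ˡ-↑ʳ : ∀ i a → adjoin g (i ↑ˡ j) (n ↑ʳ a) ≡ lookup (g a) i
    adjoin-↑ˡ-↑ʳ i a rewrite splitAt-↑ˡ n i j | splitAt-↑ʳ n j a = refl

    adjoin-↑ʳ-↑ˡ : ∀ a i → adjoin g (n ↑ʳ a) (i ↑ˡ j) ≡ false
    adjoin-↑ʳ-↑ˡ a i rewrite splitAt-↑ˡ n i j | splitAt-↑ʳ n j a = refl

    adjoin-↑ʳ-↑ʳ : ∀ a b → adjoin g (n ↑ʳ a) (n ↑ʳ b) ≡ q a b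
    adjoin-↑ʳ-↑ʳ a b rewrite splitAt-↑ʳ n j a | splitAt-↑ʳ n j b = refl

    adjoin-↑ˡ-↑ˡ⇒≡ : ∀ {i i′} → T (adjoin g (i ↑ˡ j) (i′ ↑ˡ j)) → i ≡ i′
    adjoin-↑ˡ-↑ˡ⇒≡ {i} {i′} i≤i′ = T-does⁻ (i ≟ᶠ i′) (subst T (adjoin-↑ˡ-↑ˡ i i′) i≤i′)

    adjoin-↑ʳ-≰-↑ˡ : ∀ {a i} → ¬ T (adjoin g (n ↑ʳ a) (i ↑ˡ j))
    adjoin-↑ʳ-≰-↑ˡ {a} {i} = subst T (adjoin-↑ʳ-↑ˡ a i)

    adjoin-↑ˡ-↑ʳ-∈ : ∀ {i a} → T (adjoin g (i ↑ˡ j) (n ↑ʳ a)) → i ∈ g a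
    adjoin-↑ˡ-↑ʳ-∈ {i} {a} = T-lookup⇒∈ ∘ subst T (adjoin-↑ˡ-↑ʳ i a)

    ∈-adjoin-↑ˡ-↑ʳ : ∀ {i a} → i ∈ g a → T (adjoin g (i ↑ˡ j) (n ↑ʳ a))
    ∈-adjoin-↑ˡ-↑ʳ {i} {a} = subst T (sym (adjoin-↑ˡ-↑ʳ i a)) ∘ ∈⇒T-lookup

    adjoin-isExtension : IsPoset q → InF q g → IsExtension n q (adjoin g)
    adjoin-isExtension (q-refl , q-antisym , q-trans) (g-ne , g-mono) =
      (a-refl , a-antisym , a-trans) , adjoin-↑ʳ-↑ʳ , N-min , L-nonmin
      where
      a-refl : ∀ x → T (adjoin g x x)
      a-refl x with splitView n j x
      ... | inN i = subst T (sym (adjoin-↑ˡ-↑ˡ i i)) (T-does⁺ (i ≟ᶠ i) refl)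
      ... | inL a = subst T (sym (adjoin-↑ʳ-↑ʳ a a)) (q-refl a)

      a-antisym : ∀ x y → T (adjoin g x y) → T (adjoin g y x) → x ≡ y
      a-antisym x y x≤y y≤x with splitView n j x | splitView n j y
      ... | inN i | inN i′ = cong (_↑ˡ j) (adjoin-↑ˡ-↑ˡ⇒≡ x≤y)
      ... | inN i | inL a  = ⊥-elim (adjoin-↑ʳ-≰-↑ˡ y≤x)
      ... | inL a | inN i  = ⊥-elim (adjoin-↑ʳ-≰-↑ˡ x≤y)
      ... | inL a | inL b  = cong (n ↑ʳ_)
        (q-antisym a b (subst T (adjoin-↑ʳ-↑ʳ a b) x≤y) (subst T (adjoin-↑ʳ-↑ʳ b a) y≤x))

      a-trans : ∀ x y z → T (adjoin g x y) → T (adjoin g y z) → T (adjoin g x z)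
      a-trans x y z x≤y y≤z with splitView n j x | splitView n j y | splitView n j z
      ... | inN i | inN i′ | _     with adjoin-↑ˡ-↑ˡ⇒≡ x≤y
      ...   | refl = y≤z
      a-trans _ _ _ x≤y y≤z | inN i | inL a | inN i′ = ⊥-elim (adjoin-↑ʳ-≰-↑ˡ y≤z)
      a-trans _ _ _ x≤y y≤z | inN i | inL a | inL b  =
        ∈-adjoin-↑ˡ-↑ʳ (g-mono a b (subst T (adjoin-↑ʳ-↑ʳ a b) y≤z) (adjoin-↑ˡ-↑ʳ-∈ x≤y))
      a-trans _ _ _ x≤y y≤z | inL a | inN i  | _     = ⊥-elim (adjoin-↑ʳ-≰-↑ˡ x≤y)
      a-trans _ _ _ x≤y y≤z | inL a | inL b  | inN i = ⊥-elim (adjoin-↑ʳ-≰-↑ˡ y≤z)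
      a-trans _ _ _ x≤y y≤z | inL a | inL b  | inL c = subst T (sym (adjoin-↑ʳ-↑ʳ a c))
        (q-trans a b c (subst T (adjoin-↑ʳ-↑ʳ a b) x≤y) (subst T (adjoin-↑ʳ-↑ʳ b c) y≤z))

      N-min : ∀ i → IsMinimal (adjoin g) (i ↑ˡ j)
      N-min i w w≤i with splitView n j w
      ... | inN i′ = cong (_↑ˡ j) (adjoin-↑ˡ-↑ˡ⇒≡ w≤i)
      ... | inL a  = ⊥-elim (adjoin-↑ʳ-≰-↑ˡ w≤i)

      L-nonmin : ∀ a → ¬ IsMinimal (adjoin g) (n ↑ʳ a)
      L-nonmin a a-min = let (i , i∈ga) = g-ne a in ↑ˡ≢↑ʳ i a (a-min (i ↑ˡ j) (∈-adjoin-↑ˡ-↑ʳ i∈ga))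

  below : BRel (n + j) → Fin j → Subset n
  below r a = tabulate λ i → r (i ↑ˡ j) (n ↑ʳ a)

  module _ {r : BRel (n + j)} (r-ext : IsExtension n q r) where

    private
      r-poset = proj₁ r-ext
      r-restricts = proj₁ (proj₂ r-ext)
      N-min = proj₁ (proj₂ (proj₂ r-ext))
      L-nonmin = proj₂ (proj₂ (proj₂ r-ext))

    below-InF : InF q (below r)
    below-InF = below-ne , below-mono
      where
      below-ne : ∀ a → Nonempty (below r a)
      below-ne a with minimal-below r r-poset (n ↑ʳ a)
      ... | w , w≤a , w-min with splitView n j w
      ...   | inN i = i , ∈-tabulate⁺ _ w≤a
      ...   | inL b = ⊥-elim (L-nonmin b w-min)
      below-mono : ∀ a b → T (q a b) → below r a ⊆ below r b
      below-mono a b a≤b i∈ = ∈-tabulate⁺ _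
        (proj₂ (proj₂ r-poset) _ _ _ (∈-tabulate⁻ _ i∈) (subst T (sym (r-restricts a b)) a≤b))

    adjoin-below : ∀ {g} → (∀ a → g a ≡ below r a) → ∀ x y → adjoin g x y ≡ r x y
    adjoin-below {g} g≗below x y with splitView n j x | splitView n j y
    ... | inN i | inN i′ with i ≟ᶠ i′ | adjoin-↑ˡ-↑ˡ g i i′
    ...   | yes refl | eq = trans eq (T-ext (λ _ → proj₁ r-poset (i ↑ˡ j)) (λ _ → tt))
    ...   | no i≢i′  | eq with r (i ↑ˡ j) (i′ ↑ˡ j) in r≡
    ...     | true  = ⊥-elim (i≢i′ (↑ˡ-injective j i i′ (N-min i′ _ (subst T (sym r≡) tt))))
    ...     | false = eq
    adjoin-below {g} g≗below x y | inN i | inL a =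
      trans (adjoin-↑ˡ-↑ʳ g i a) (trans (cong (λ s → lookup s i) (g≗below a)) (lookup∘tabulate _ i))
    adjoin-below {g} g≗below x y | inL a | inN i with r (n ↑ʳ a) (i ↑ˡ j) in r≡
    ... | true  = ⊥-elim (↑ˡ≢↑ʳ i a (sym (N-min i _ (subst T (sym r≡) tt))))
    ... | false = adjoin-↑ʳ-↑ˡ g a i
    adjoin-below {g} g≗below x y | inL a | inL b = trans (adjoin-↑ʳ-↑ʳ g a b) (sym (r-restricts a b))

  below-adjoin : ∀ g a → below (adjoin g) a ≡ g a
  below-adjoin g a = trans (tabulate-cong (λ i → adjoin-↑ˡ-↑ʳ g i a)) (tabulate∘lookup (g a))

tabulate² : ∀ {N} → BRel N → Vec (Vec Bool N) N
tabulate² r = tabulate (tabulate ∘ r)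

toRel-tabulate² : ∀ {N} (r : BRel N) x y → toRel (tabulate² r) x y ≡ r x y
toRel-tabulate² r x y = trans (cong (λ row → lookup row y) (lookup∘tabulate _ x)) (lookup∘tabulate (r x) y)

tabulate²-cong : ∀ {N} {r r′ : BRel N} → (∀ x y → r x y ≡ r′ x y) → tabulate² r ≡ tabulate² r′
tabulate²-cong r≐r′ = tabulate-cong (λ x → tabulate-cong (r≐r′ x))

tabulate²-toRel : ∀ {N} (R : Vec (Vec Bool N) N) → tabulate² (toRel R) ≡ R
tabulate²-toRel R = trans (tabulate-cong (λ x → tabulate∘lookup (lookup R x))) (tabulate∘lookup R)

e≡countF : ∀ n {j} (q : BRel j) → IsPoset q → e n q ≡ countF n q
e≡countF n {j} q q-poset = length-filter-bijection
  (vectors (vectors bools (n + j)) (n + j)) (vectors (vectors bools n) j)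
  (λ R → isExtension? n q (toRel R)) (InF? q ∘ lookup)
  (λ R → tabulate (below (toRel R))) (λ g → tabulate² (adjoin (lookup g)))
  (λ R-ext → InF-cong (λ a → sym (lookup∘tabulate _ a)) (below-InF R-ext))
  (λ {g} g-InF → IsExtension-cong n (λ x y → sym (toRel-tabulate² _ x y))
                   (adjoin-isExtension (lookup g) q-poset g-InF))
  (λ {R} R-ext → trans (tabulate²-cong (adjoin-below R-ext (lookup∘tabulate _))) (tabulate²-toRel R))
  (λ {g} _ → trans (tabulate-cong (λ a → trans (tabulate-cong (λ i → toRel-tabulate² _ (i ↑ˡ j) (n ↑ʳ a)))
                                                (below-adjoin (lookup g) a)))
                   (tabulate∘lookup g))
  where open Adjoin n q

data LastView (n : ℕ) : Fin (suc n) → Set where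
  inner : (i : Fin n) → LastView n (inject₁ i)
  top   : LastView n (fromℕ n)

lastView : ∀ n (x : Fin (suc n)) → LastView n x
lastView zero    fzero    = top
lastView (suc n) fzero    = inner fzero
lastView (suc n) (fsuc x) with lastView n x
... | inner i = inner (fsuc i)
... | top     = top

lookup-∷ʳ-inject₁ : ∀ {n} (v : Vec A n) b i → lookup (v ∷ʳ b) (inject₁ i) ≡ lookup v i
lookup-∷ʳ-inject₁ (x ∷ v) b fzero    = refl
lookup-∷ʳ-inject₁ (x ∷ v) b (fsuc i) = lookup-∷ʳ-inject₁ v b i

lookup-∷ʳ-fromℕ : ∀ {n} (v : Vec A n) b → lookup (v ∷ʳ b) (fromℕ n) ≡ b
lookup-∷ʳ-fromℕ []      b = refl
lookup-∷ʳ-fromℕ (x ∷ v) b = lookup-∷ʳ-fromℕ v b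

init-∷ʳ-last : ∀ {n} (v : Vec A (suc n)) → init v ∷ʳ last v ≡ v
init-∷ʳ-last v = let (_ , _ , v≡) = initLast v in sym v≡

module _ {n} {s : Subset n} {b : Bool} where

  inject₁-∈-∷ʳ⁺ : ∀ {i} → i ∈ s → inject₁ i ∈ s ∷ʳ b
  inject₁-∈-∷ʳ⁺ {i} = T-lookup⇒∈ ∘ subst T (sym (lookup-∷ʳ-inject₁ s b i)) ∘ ∈⇒T-lookup

  inject₁-∈-∷ʳ⁻ : ∀ {i} → inject₁ i ∈ s ∷ʳ b → i ∈ s
  inject₁-∈-∷ʳ⁻ {i} = T-lookup⇒∈ ∘ subst T (lookup-∷ʳ-inject₁ s b i) ∘ ∈⇒T-lookup

  fromℕ-∈-∷ʳ⁺ : T b → fromℕ n ∈ s ∷ʳ b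
  fromℕ-∈-∷ʳ⁺ = T-lookup⇒∈ ∘ subst T (sym (lookup-∷ʳ-fromℕ s b))

  fromℕ-∈-∷ʳ⁻ : fromℕ n ∈ s ∷ʳ b → T b
  fromℕ-∈-∷ʳ⁻ = subst T (lookup-∷ʳ-fromℕ s b) ∘ ∈⇒T-lookup

  ∷ʳ-nonempty⁺ : Nonempty s ⊎ T b → Nonempty (s ∷ʳ b)
  ∷ʳ-nonempty⁺ (inj₁ (i , i∈s)) = inject₁ i , inject₁-∈-∷ʳ⁺ i∈s
  ∷ʳ-nonempty⁺ (inj₂ b-true)    = fromℕ n , fromℕ-∈-∷ʳ⁺ b-true

  ∷ʳ-nonempty⁻ : Nonempty (s ∷ʳ b) → Nonempty s ⊎ T b
  ∷ʳ-nonempty⁻ (x , x∈) with lastView n x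
  ... | inner i = inj₁ (i , inject₁-∈-∷ʳ⁻ x∈)
  ... | top     = inj₂ (fromℕ-∈-∷ʳ⁻ x∈)

module _ {n} {s s′ : Subset n} {b b′ : Bool} where

  ∷ʳ-⊆⁺ : s ⊆ s′ → (T b → T b′) → s ∷ʳ b ⊆ s′ ∷ʳ b′
  ∷ʳ-⊆⁺ s⊆s′ b⇒b′ {x} x∈ with lastView n x
  ... | inner i = inject₁-∈-∷ʳ⁺ (s⊆s′ (inject₁-∈-∷ʳ⁻ x∈))
  ... | top     = fromℕ-∈-∷ʳ⁺ (b⇒b′ (fromℕ-∈-∷ʳ⁻ x∈))

  ∷ʳ-⊆⁻ˡ : s ∷ʳ b ⊆ s′ ∷ʳ b′ → s ⊆ s′
  ∷ʳ-⊆⁻ˡ ⊆′ = inject₁-∈-∷ʳ⁻ ∘ ⊆′ ∘ inject₁-∈-∷ʳ⁺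

  ∷ʳ-⊆⁻ʳ : s ∷ʳ b ⊆ s′ ∷ʳ b′ → T b → T b′
  ∷ʳ-⊆⁻ʳ ⊆′ = fromℕ-∈-∷ʳ⁻ ∘ ⊆′ ∘ fromℕ-∈-∷ʳ⁺

⁅fromℕ⁆≡⊥∷ʳtrue : ∀ n → ⁅ fromℕ n ⁆ ≡ ⊥ ∷ʳ true
⁅fromℕ⁆≡⊥∷ʳtrue zero    = refl
⁅fromℕ⁆≡⊥∷ʳtrue (suc n) = cong (false ∷_) (⁅fromℕ⁆≡⊥∷ʳtrue n)

⊆⁅⁆⇒≡ : ∀ {n} {s : Subset n} {x} → Nonempty s → s ⊆ ⁅ x ⁆ → s ≡ ⁅ x ⁆
⊆⁅⁆⇒≡ {x = x} (y , y∈s) s⊆⁅x⁆ = ⊆-antisym s⊆⁅x⁆ ⁅x⁆⊆s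
  where
  ⁅x⁆⊆s : ⁅ x ⁆ ⊆ _
  ⁅x⁆⊆s z∈⁅x⁆ with x∈⁅y⁆⇒x≡y x z∈⁅x⁆ | x∈⁅y⁆⇒x≡y x (s⊆⁅x⁆ y∈s)
  ... | refl | refl = y∈s

module _ {k} {le : BRel k} where

  ∈-up⁺ : ∀ {S s y} → s ∈ S → T (le s y) → y ∈ up le S
  ∈-up⁺ {S} s∈S s≤y = ∈-tabulate-does⁺ (λ y → any? λ s → (s ∈? S) ×-dec T? (le s y)) (_ , s∈S , s≤y)

  ∈-up⁻ : ∀ {S y} → y ∈ up le S → ∃ λ s → s ∈ S × T (le s y)
  ∈-up⁻ {S} = ∈-tabulate-does⁻ (λ y → any? λ s → (s ∈? S) ×-dec T? (le s y))

  ⊆-up : ∀ {S} → IsPoset le → S ⊆ up le S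
  ⊆-up (le-refl , _) {x} x∈S = ∈-up⁺ x∈S (le-refl x)

  up-isUpset : ∀ {S} → IsPoset le → IsUpset le (up le S)
  up-isUpset (_ , _ , le-trans) x y x≤y x∈ =
    let (s , s∈S , s≤x) = ∈-up⁻ x∈ in ∈-up⁺ s∈S (le-trans s x y s≤x x≤y)

_≟ˢ_ : ∀ {n} → DecidableEquality (Subset n)
_≟ˢ_ = ≡-dec _≟ᵇ_

onlyTop : ∀ {k m} → (Fin k → Subset (suc m)) → Subset k
onlyTop {m = m} g = tabulate λ x → does (g x ≟ˢ ⁅ fromℕ m ⁆)

module _ {k m} {g : Fin k → Subset (suc m)} where

  ∈-onlyTop⁺ : ∀ {x} → g x ≡ ⁅ fromℕ m ⁆ → x ∈ onlyTop g
  ∈-onlyTop⁺ = ∈-tabulate-does⁺ (λ x → g x ≟ˢ ⁅ fromℕ m ⁆)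

  ∈-onlyTop⁻ : ∀ {x} → x ∈ onlyTop g → g x ≡ ⁅ fromℕ m ⁆
  ∈-onlyTop⁻ = ∈-tabulate-does⁻ (λ x → g x ≟ˢ ⁅ fromℕ m ⁆)

  onlyTop-cong : ∀ {g′} → (∀ x → g x ≡ g′ x) → onlyTop g ≡ onlyTop g′
  onlyTop-cong g≗g′ = tabulate-cong (λ x → cong (λ s → does (s ≟ˢ ⁅ fromℕ m ⁆)) (g≗g′ x))

  init-onlyTop : ∀ {x} → x ∈ onlyTop g → init (g x) ≡ ⊥
  init-onlyTop x∈ = trans (cong init (trans (∈-onlyTop⁻ x∈) (⁅fromℕ⁆≡⊥∷ʳtrue m))) (init-∷ʳ true ⊥)

  module _ {le : BRel k} (g-InF : InF le g) where

    private
      g-ne = proj₁ g-InF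
      g-mono = proj₂ g-InF
      g-mono′ : ∀ x y → T (le x y) → init (g x) ∷ʳ last (g x) ⊆ init (g y) ∷ʳ last (g y)
      g-mono′ x y x≤y = subst₂ _⊆_ (sym (init-∷ʳ-last (g x))) (sym (init-∷ʳ-last (g y))) (g-mono x y x≤y)

    init-mono : ∀ x y → T (le x y) → init (g x) ⊆ init (g y)
    init-mono x y = ∷ʳ-⊆⁻ˡ ∘ g-mono′ x y

    last-mono : ∀ x y → T (le x y) → T (last (g x)) → T (last (g y))
    last-mono x y = ∷ʳ-⊆⁻ʳ ∘ g-mono′ x y

    onlyTop-isDownset : IsDownset le (onlyTop g)
    onlyTop-isDownset x y x≤y y∈ =
      ∈-onlyTop⁺ (⊆⁅⁆⇒≡ (g-ne x) (subst (g x ⊆_) (∈-onlyTop⁻ y∈) (g-mono x y x≤y)))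

    init-nonempty : ∀ x → x ∉ onlyTop g → Nonempty (init (g x))
    init-nonempty x x∉ with nonempty? (init (g x))
    ... | yes ne = ne
    ... | no ¬ne with ∷ʳ-nonempty⁻ (subst Nonempty (sym (init-∷ʳ-last (g x))) (g-ne x))
    ...   | inj₁ ne = contradiction ne ¬ne
    ...   | inj₂ last-true = contradiction (∈-onlyTop⁺ (begin
      g x                         ≡⟨ init-∷ʳ-last (g x) ⟨
      init (g x) ∷ʳ last (g x)    ≡⟨ cong₂ _∷ʳ_ (Empty-unique ¬ne) (T-ext (λ _ → tt) (λ _ → last-true)) ⟩
      ⊥ ∷ʳ true                   ≡⟨ ⁅fromℕ⁆≡⊥∷ʳtrue m ⟨
      ⁅ fromℕ m ⁆                 ∎)) x∉
      where open ≡-Reasoning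

    last-up-onlyTop : ∀ {x} → x ∈ up le (onlyTop g) → T (last (g x))
    last-up-onlyTop {x} x∈ with ∈-up⁻ x∈
    ... | s , s∈ , s≤x = fromℕ-∈-∷ʳ⁻ (subst (fromℕ m ∈_) (sym (init-∷ʳ-last (g x)))
                           (g-mono s x s≤x (subst (fromℕ m ∈_) (sym (∈-onlyTop⁻ s∈)) (x∈⁅x⁆ (fromℕ m)))))

-- The bijection F'(M, P) → F({1,…,m+1}, P)

module Assemble {k m} (D : Subset k) (h : (x : Fin k) → x ∉ D → Subset m) where

  extendBy⊥ : Fin k → Subset m
  extendBy⊥ x with x ∈? D
  ... | yes _  = ⊥
  ... | no x∉D = h x x∉D

  extendBy⊥-∉ : ∀ {x s} → x ∉ D → (∀ x∉D → h x x∉D ≡ s) → extendBy⊥ x ≡ s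
  extendBy⊥-∉ {x} x∉D h≡s with x ∈? D
  ... | yes x∈D = contradiction x∈D x∉D
  ... | no x∉D′ = h≡s x∉D′

  -- The paper's f_{m+1} when b is the indicator of U ∪ DP.
  assemble : (Fin k → Bool) → Fin k → Subset (suc m)
  assemble b x = extendBy⊥ x ∷ʳ b x

  module _ {b : Fin k → Bool} (h-ne : ∀ x x∉D → Nonempty (h x x∉D)) (b-D : ∀ {x} → x ∈ D → T (b x)) where

    assemble-InF : {le : BRel k} → IsDownset le D →
      (∀ x y x∉D y∉D → T (le x y) → h x x∉D ⊆ h y y∉D) →
      (∀ x y → T (le x y) → T (b x) → T (b y)) → InF le (assemble b)
    assemble-InF {le} D-down h-mono b-mono = nonempty , λ x y x≤y → ∷ʳ-⊆⁺ (extendBy⊥-mono x y x≤y) (b-mono x y x≤y)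
      where
      nonempty : ∀ x → Nonempty (assemble b x)
      nonempty x with x ∈? D
      ... | yes x∈D = ∷ʳ-nonempty⁺ (inj₂ (b-D x∈D))
      ... | no x∉D  = ∷ʳ-nonempty⁺ (inj₁ (h-ne x x∉D))
      extendBy⊥-mono : ∀ x y → T (le x y) → extendBy⊥ x ⊆ extendBy⊥ y
      extendBy⊥-mono x y x≤y with x ∈? D | y ∈? D
      ... | yes _   | _       = ⊥⊆
      ... | no x∉D  | yes y∈D = contradiction (D-down x y x≤y y∈D) x∉D
      ... | no x∉D  | no y∉D  = h-mono x y x∉D y∉D x≤y

    assemble-∈D : ∀ {x} → x ∈ D → assemble b x ≡ ⁅ fromℕ m ⁆
    assemble-∈D {x} x∈D with x ∈? D
    ... | yes _  = trans (cong (⊥ ∷ʳ_) (T-ext (λ _ → tt) (λ _ → b-D x∈D))) (sym (⁅fromℕ⁆≡⊥∷ʳtrue m))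
    ... | no x∉D = contradiction x∈D x∉D

    onlyTop-assemble : onlyTop (assemble b) ≡ D
    onlyTop-assemble = ⊆-antisym (λ {x} → onlyTop⊆D x) (λ {x} → D⊆onlyTop x)
      where
      onlyTop⊆D : ∀ x → x ∈ onlyTop (assemble b) → x ∈ D
      onlyTop⊆D x x∈ with x ∈? D | ∈-onlyTop⁻ {g = assemble b} x∈
      ... | yes x∈D | _   = x∈D
      ... | no x∉D  | eq with h-ne x x∉D
      ...   | i , i∈h =
        contradiction (subst (i ∈_) (∷ʳ-injectiveˡ _ ⊥ (trans eq (⁅fromℕ⁆≡⊥∷ʳtrue m))) i∈h) ∉⊥
      D⊆onlyTop : ∀ x → x ∈ D → x ∈ onlyTop (assemble b)
      D⊆onlyTop x x∈D = ∈-onlyTop⁺ {g = assemble b} (assemble-∈D x∈D)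

module _ {k} (m : ℕ) {le : BRel k} (le-poset : IsPoset le) where

  open Assemble using (extendBy⊥; assemble)

  U∪up? : (t : Triple m le) → Decidable (λ x → x ∈ U t ⊎ x ∈ up le (D t))
  U∪up? t x = (x ∈? U t) ⊎-dec (x ∈? up le (D t))

  topBit : Triple m le → Fin k → Bool
  topBit t x = does (U∪up? t x)

  module _ (t : Triple m le) where

    topBit-D : ∀ {x} → x ∈ D t → T (topBit t x)
    topBit-D {x} x∈D = T-does⁺ (U∪up? t x) (inj₂ (⊆-up le-poset x∈D))

    topBit-mono : ∀ x y → T (le x y) → T (topBit t x) → T (topBit t y)
    topBit-mono x y x≤y x-top = T-does⁺ (U∪up? t y) (in-U∪up (T-does⁻ (U∪up? t x) x-top))
      where
      in-U∪up : x ∈ U t ⊎ x ∈ up le (D t) → y ∈ U t ⊎ y ∈ up le (D t)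
      in-U∪up (inj₂ x∈up) = inj₂ (up-isUpset le-poset x y x≤y x∈up)
      in-U∪up (inj₁ x∈U) with y ∈? up le (D t)
      ... | yes y∈up = inj₂ y∈up
      ... | no y∉up  = inj₁ (proj₂ (U-up t) x y (proj₁ (U-up t) x x∈U) y∉up x≤y x∈U)

    liftTriple≗assemble : ∀ x → liftTriple t x ≡ assemble (D t) (f t) (topBit t) x
    liftTriple≗assemble x with x ∈? D t
    ... | yes x∈D = trans (⁅fromℕ⁆≡⊥∷ʳtrue m) (cong (⊥ ∷ʳ_) (T-ext (λ _ → topBit-D x∈D) (λ _ → tt)))
    ... | no x∉D with x ∈? U t | x ∈? up le (D t)
    ...   | yes _ | _     = refl
    ...   | no _  | yes _ = refl
    ...   | no _  | no _  = refl

    liftTriple-InF : InF le (liftTriple t)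
    liftTriple-InF = InF-cong (sym ∘ liftTriple≗assemble)
      (Assemble.assemble-InF (D t) (f t) (f-ne t) topBit-D (D-down t) (f-mono t) topBit-mono)

    onlyTop-liftTriple : onlyTop (liftTriple t) ≡ D t
    onlyTop-liftTriple = trans (onlyTop-cong liftTriple≗assemble)
      (Assemble.onlyTop-assemble (D t) (f t) (f-ne t) topBit-D)

    init-liftTriple : ∀ {x} (x∉D : x ∉ D t) → init (liftTriple t x) ≡ f t x x∉D
    init-liftTriple {x} x∉D = begin
      init (liftTriple t x)                          ≡⟨ cong init (liftTriple≗assemble x) ⟩
      init (extendBy⊥ (D t) (f t) x ∷ʳ topBit t x)   ≡⟨ init-∷ʳ (topBit t x) _ ⟩
      extendBy⊥ (D t) (f t) x                        ≡⟨ Assemble.extendBy⊥-∉ (D t) (f t) x∉D f-irrelevant ⟩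
      f t x x∉D                                      ∎
      where
      open ≡-Reasoning
      f-irrelevant : ∀ x∉D′ → f t x x∉D′ ≡ f t x x∉D
      f-irrelevant x∉D′ =
        ⊆-antisym (f-mono t x x x∉D′ x∉D (proj₁ le-poset x)) (f-mono t x x x∉D x∉D′ (proj₁ le-poset x))

    last-liftTriple : ∀ x → last (liftTriple t x) ≡ topBit t x
    last-liftTriple x = trans (cong last (liftTriple≗assemble x)) (last-∷ʳ (topBit t x) (extendBy⊥ (D t) (f t) x))

  liftTriple-injective : (t t′ : Triple m le) → (∀ x → liftTriple t x ≡ liftTriple t′ x) → SameTriple t t′
  liftTriple-injective t t′ t≗t′ = D≡ , ⊆-antisym (U⊆ t t′ D≡ t≗t′) (U⊆ t′ t (sym D≡) (sym ∘ t≗t′)) , f≡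
    where
    D≡ : D t ≡ D t′
    D≡ = trans (sym (onlyTop-liftTriple t)) (trans (onlyTop-cong t≗t′) (onlyTop-liftTriple t′))
    f≡ : ∀ x x∉D x∉D′ → f t x x∉D ≡ f t′ x x∉D′
    f≡ x x∉D x∉D′ = trans (sym (init-liftTriple t x∉D)) (trans (cong init (t≗t′ x)) (init-liftTriple t′ x∉D′))
    U⊆ : ∀ s s′ → D s ≡ D s′ → (∀ x → liftTriple s x ≡ liftTriple s′ x) → U s ⊆ U s′
    U⊆ s s′ D≡ s≗s′ {x} x∈U
      with T-does⁻ (U∪up? s′ x) (subst T topBit≡ (T-does⁺ (U∪up? s x) (inj₁ x∈U)))
      where
      topBit≡ : topBit s x ≡ topBit s′ x
      topBit≡ = trans (sym (last-liftTriple s x)) (trans (cong last (s≗s′ x)) (last-liftTriple s′ x))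
    ... | inj₁ x∈U′  = x∈U′
    ... | inj₂ x∈up′ = contradiction (subst (λ D → x ∈ up le D) (sym D≡) x∈up′) (proj₁ (U-up s) x x∈U)

  liftTriple-surjective : (g : Fin k → Subset (suc m)) → InF le g →
    Σ (Triple m le) λ t → ∀ x → liftTriple t x ≡ g x
  liftTriple-surjective g g-InF = t , λ x → begin
    liftTriple t x                                 ≡⟨ liftTriple≗assemble t x ⟩
    extendBy⊥ D₀ (f t) x ∷ʳ topBit t x             ≡⟨ cong₂ _∷ʳ_ (extendBy⊥≡init x) (topBit≡last x) ⟩
    init (g x) ∷ʳ last (g x)                       ≡⟨ init-∷ʳ-last (g x) ⟩
    g x                                            ∎
    where
    open ≡-Reasoning
    D₀ = onlyTop g
    U? : Decidable (λ x → T (last (g x)) × x ∉ up le D₀)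
    U? x = T? (last (g x)) ×-dec ¬? (x ∈? up le D₀)
    U-up₀ : IsUpsetOfMinus le (up le D₀) (tabulate (does ∘ U?))
    U-up₀ = (λ x x∈U → proj₂ (∈-tabulate-does⁻ U? x∈U)) ,
            (λ x y _ y∉up x≤y x∈U →
               ∈-tabulate-does⁺ U? (last-mono g-InF x y x≤y (proj₁ (∈-tabulate-does⁻ U? x∈U)) , y∉up))
    t : Triple m le
    t = record
      { D = D₀ ; D-down = onlyTop-isDownset g-InF
      ; U = tabulate (does ∘ U?) ; U-up = U-up₀
      ; f = λ x _ → init (g x) ; f-ne = init-nonempty g-InF ; f-mono = λ x y _ _ → init-mono g-InF x y
      }
    extendBy⊥≡init : ∀ x → extendBy⊥ D₀ (f t) x ≡ init (g x)
    extendBy⊥≡init x with x ∈? D₀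
    ... | yes x∈D = sym (init-onlyTop {g = g} x∈D)
    ... | no _    = refl
    topBit≡last : ∀ x → topBit t x ≡ last (g x)
    topBit≡last x = T-ext (top⇒last ∘ T-does⁻ (U∪up? t x)) (T-does⁺ (U∪up? t x) ∘ last⇒top)
      where
      top⇒last : x ∈ U t ⊎ x ∈ up le D₀ → T (last (g x))
      top⇒last (inj₁ x∈U)  = proj₁ (∈-tabulate-does⁻ U? x∈U)
      top⇒last (inj₂ x∈up) = last-up-onlyTop g-InF x∈up
      last⇒top : T (last (g x)) → x ∈ U t ⊎ x ∈ up le D₀
      last⇒top x-last with x ∈? up le D₀
      ... | yes x∈up = inj₂ x∈up
      ... | no x∉up  = inj₁ (∈-tabulate-does⁺ U? (x-last , x∉up))

-- Counting F({1,…,m+1}, P) by the downset D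

lookup-injective : ∀ {xs : List A} → Unique xs → ∀ {i j} → lookupₗ xs i ≡ lookupₗ xs j → i ≡ j
lookup-injective {xs = _ ∷ _} _          {fzero}  {fzero}  _  = refl
lookup-injective {xs = _ ∷ _} (x∉xs ∷ _) {fzero}  {fsuc j} eq = contradiction eq (All.lookup x∉xs (∈-lookup j))
lookup-injective {xs = _ ∷ _} (x∉xs ∷ _) {fsuc i} {fzero}  eq = contradiction (sym eq) (All.lookup x∉xs (∈-lookup i))
lookup-injective {xs = _ ∷ _} (_ ∷ u)    {fsuc i} {fsuc j} eq = cong fsuc (lookup-injective u eq)

module Positions {k} (S : Subset k) where

  elems-unique : Unique (elems S)
  elems-unique = Unique.filter⁺ (_∈? S) (Unique.allFin⁺ k)

  lookup-elems-∈ : ∀ i → lookupₗ (elems S) i ∈ S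
  lookup-elems-∈ i = proj₂ (∈-filter⁻ (_∈? S) {xs = allFin k} (∈-lookup i))

  indexOf : ∀ {x} → x ∈ S → Fin (length (elems S))
  indexOf {x} x∈S = index (∈-filter⁺ (_∈? S) (∈-allFin x) x∈S)

  lookup-indexOf : ∀ {x} (x∈S : x ∈ S) → lookupₗ (elems S) (indexOf x∈S) ≡ x
  lookup-indexOf {x} x∈S = sym (lookup-index (∈-filter⁺ (_∈? S) (∈-allFin x) x∈S))

  indexOf-lookup : ∀ {i} (x∈S : lookupₗ (elems S) i ∈ S) → indexOf x∈S ≡ i
  indexOf-lookup x∈S = lookup-injective elems-unique (lookup-indexOf x∈S)

  indexOf-irrelevant : ∀ {x} (x∈S x∈S′ : x ∈ S) → indexOf x∈S ≡ indexOf x∈S′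
  indexOf-irrelevant x∈S x∈S′ = lookup-injective elems-unique (trans (lookup-indexOf x∈S) (sym (lookup-indexOf x∈S′)))

  module _ {le : BRel k} where

    induced-≤ : ∀ {x y} (x∈S : x ∈ S) (y∈S : y ∈ S) → T (le x y) → T (induced le S (indexOf x∈S) (indexOf y∈S))
    induced-≤ x∈S y∈S = subst₂ (λ x y → T (le x y)) (sym (lookup-indexOf x∈S)) (sym (lookup-indexOf y∈S))

    induced-isPoset : IsPoset le → IsPoset (induced le S)
    induced-isPoset (le-refl , le-antisym , le-trans) =
      (λ _ → le-refl _) , (λ _ _ p q → lookup-injective elems-unique (le-antisym _ _ p q)) , (λ _ _ _ → le-trans _ _ _)

module Decomposition {k} (m : ℕ) {le : BRel k} (le-poset : IsPoset le) (D : Subset k) (D-down : IsDownset le D) where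

  private
    module P−D  = Positions (∁ D)
    module P−DP = Positions (∁ (up le D))
    Q₁ = induced le (∁ D)
    Q₂ = induced le (∁ (up le D))
    j₁ = length (elems (∁ D))
    j₂ = length (elems (∁ (up le D)))
    x₁ = lookupₗ (elems (∁ D))
    x₂ = lookupₗ (elems (∁ (up le D)))

  HasOnlyTop : Vec (Subset (suc m)) k → Set
  HasOnlyTop g = InF le (lookup g) × onlyTop (lookup g) ≡ D

  hasOnlyTop? : ∀ g → Dec (HasOnlyTop g)
  hasOnlyTop? g = InF? le (lookup g) ×-dec (onlyTop (lookup g) ≟ˢ D)

  -- The first component is (P − DP) ∖ U, a downset of P − DP.
  Code : Set
  Code = Subset j₂ × Vec (Subset m) j₁

  IsCode : Code → Set
  IsCode (E , v) = IsDownset Q₂ E × InF Q₁ (lookup v)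

  isCode? : ∀ c → Dec (IsCode c)
  isCode? c = isDownset? Q₂ (proj₁ c) ×-dec InF? Q₁ (lookup (proj₂ c))

  encode : Vec (Subset (suc m)) k → Code
  encode g = tabulate (λ i → not (last (lookup g (x₂ i)))) , tabulate (λ i → init (lookup g (x₁ i)))

  topBitOf : Subset j₂ → Fin k → Bool
  topBitOf E x with x ∈? up le D
  ... | yes _    = true
  ... | no x∉DP  = not (lookup E (P−DP.indexOf (x∉p⇒x∈∁p x∉DP)))

  reindex : Vec (Subset m) j₁ → (x : Fin k) → x ∉ D → Subset m
  reindex v x x∉D = lookup v (P−D.indexOf (x∉p⇒x∈∁p x∉D))

  decode : Code → Vec (Subset (suc m)) k
  decode (E , v) = tabulate (Assemble.assemble D (reindex v) (topBitOf E))

  topBitOf-up : ∀ {E x} → x ∈ up le D → topBitOf E x ≡ true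
  topBitOf-up {x = x} x∈DP with x ∈? up le D
  ... | yes _    = refl
  ... | no x∉DP  = contradiction x∈DP x∉DP

  topBitOf-∉up : ∀ {E x} (x∈ : x ∈ ∁ (up le D)) → topBitOf E x ≡ not (lookup E (P−DP.indexOf x∈))
  topBitOf-∉up {E} {x} x∈ with x ∈? up le D
  ... | yes x∈DP = contradiction x∈DP (x∈∁p⇒x∉p x∈)
  ... | no x∉DP  = cong (not ∘ lookup E) (P−DP.indexOf-irrelevant _ x∈)

  decode-hasOnlyTop : ∀ c → IsCode c → HasOnlyTop (decode c)
  decode-hasOnlyTop (E , v) (E-down , v-ne , v-mono) =
    InF-cong (λ x → sym (lookup∘tabulate _ x))
      (Assemble.assemble-InF D (reindex v) (λ _ _ → v-ne _) topBitOf-D D-down h-mono topBitOf-mono) ,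
    trans (onlyTop-cong (lookup∘tabulate _)) (Assemble.onlyTop-assemble D (reindex v) (λ _ _ → v-ne _) topBitOf-D)
    where
    topBitOf-D : ∀ {x} → x ∈ D → T (topBitOf E x)
    topBitOf-D x∈D = subst T (sym (topBitOf-up (⊆-up le-poset x∈D))) tt
    h-mono : ∀ x y x∉D y∉D → T (le x y) → reindex v x x∉D ⊆ reindex v y y∉D
    h-mono x y x∉D y∉D x≤y = v-mono _ _ (P−D.induced-≤ {le = le} (x∉p⇒x∈∁p x∉D) (x∉p⇒x∈∁p y∉D) x≤y)
    topBitOf-mono : ∀ x y → T (le x y) → T (topBitOf E x) → T (topBitOf E y)
    topBitOf-mono x y x≤y x-bit with y ∈? up le D | x ∈? up le D
    ... | yes _    | _        = tt
    ... | no y∉DP  | yes x∈DP = contradiction (up-isUpset le-poset x y x≤y x∈DP) y∉DP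
    ... | no y∉DP  | no x∉DP  = T-not-contra (∈⇒T-lookup ∘ E-down _ _ x≤y′ ∘ T-lookup⇒∈) x-bit
      where x≤y′ = P−DP.induced-≤ {le = le} (x∉p⇒x∈∁p x∉DP) (x∉p⇒x∈∁p y∉DP) x≤y

  encode-isCode : ∀ g → HasOnlyTop g → IsCode (encode g)
  encode-isCode g (g-InF , onlyTop≡D) =
    E-down , InF-cong (λ i → sym (lookup∘tabulate _ i)) (init-ne , λ i i′ → init-mono g-InF (x₁ i) (x₁ i′))
    where
    E-down : IsDownset Q₂ (proj₁ (encode g))
    E-down i i′ i≤i′ i′∈E =
      ∈-tabulate⁺ _ (T-not-contra (last-mono g-InF (x₂ i) (x₂ i′) i≤i′) (∈-tabulate⁻ _ i′∈E))
    init-ne : ∀ i → Nonempty (init (lookup g (x₁ i)))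
    init-ne i = init-nonempty g-InF (x₁ i)
      (λ x∈ → x∈∁p⇒x∉p (P−D.lookup-elems-∈ i) (subst (x₁ i ∈_) onlyTop≡D x∈))

  decode∘encode : ∀ g → HasOnlyTop g → decode (encode g) ≡ g
  decode∘encode g (g-InF , onlyTop≡D) = trans (tabulate-cong λ x →
    trans (cong₂ _∷ʳ_ (extendBy⊥≡init x) (topBitOf≡last x)) (init-∷ʳ-last (lookup g x))) (tabulate∘lookup g)
    where
    extendBy⊥≡init : ∀ x → Assemble.extendBy⊥ D (reindex (proj₂ (encode g))) x ≡ init (lookup g x)
    extendBy⊥≡init x with x ∈? D
    ... | yes x∈D = sym (init-onlyTop {g = lookup g} (subst (x ∈_) (sym onlyTop≡D) x∈D))
    ... | no x∉D  = trans (lookup∘tabulate (λ i → init (lookup g (x₁ i))) (P−D.indexOf x∈∁D))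
                          (cong (init ∘ lookup g) (P−D.lookup-indexOf x∈∁D))
      where x∈∁D = x∉p⇒x∈∁p x∉D
    topBitOf≡last : ∀ x → topBitOf (proj₁ (encode g)) x ≡ last (lookup g x)
    topBitOf≡last x with x ∈? up le D
    ... | yes x∈DP =
      T-ext (λ _ → last-up-onlyTop g-InF (subst (λ S → x ∈ up le S) (sym onlyTop≡D) x∈DP)) (λ _ → tt)
    ... | no x∉DP  = trans (cong not (lookup∘tabulate (λ i → not (last (lookup g (x₂ i)))) (P−DP.indexOf x∈∁DP)))
      (trans (not-involutive _) (cong (last ∘ lookup g) (P−DP.lookup-indexOf x∈∁DP)))
      where x∈∁DP = x∉p⇒x∈∁p x∉DP

  encode∘decode : ∀ c → encode (decode c) ≡ c
  encode∘decode (E , v) =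
    cong₂ _,_ (trans (tabulate-cong bits) (tabulate∘lookup E)) (trans (tabulate-cong inits) (tabulate∘lookup v))
    where
    open ≡-Reasoning
    lifted = Assemble.assemble D (reindex v) (topBitOf E)
    bits : ∀ i → not (last (lookup (tabulate lifted) (x₂ i))) ≡ lookup E i
    bits i = begin
      not (last (lookup (tabulate lifted) (x₂ i)))
        ≡⟨ cong (not ∘ last) (lookup∘tabulate lifted (x₂ i)) ⟩
      not (last (lifted (x₂ i)))
        ≡⟨ cong not (last-∷ʳ (topBitOf E (x₂ i)) (Assemble.extendBy⊥ D (reindex v) (x₂ i))) ⟩
      not (topBitOf E (x₂ i))
        ≡⟨ cong not (topBitOf-∉up (P−DP.lookup-elems-∈ i)) ⟩
      not (not (lookup E (P−DP.indexOf (P−DP.lookup-elems-∈ i))))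
        ≡⟨ not-involutive _ ⟩
      lookup E (P−DP.indexOf (P−DP.lookup-elems-∈ i))
        ≡⟨ cong (lookup E) (P−DP.indexOf-lookup _) ⟩
      lookup E i
        ∎
    inits : ∀ i → init (lookup (tabulate lifted) (x₁ i)) ≡ lookup v i
    inits i = begin
      init (lookup (tabulate lifted) (x₁ i))
        ≡⟨ cong init (lookup∘tabulate lifted (x₁ i)) ⟩
      init (lifted (x₁ i))
        ≡⟨ init-∷ʳ _ _ ⟩
      Assemble.extendBy⊥ D (reindex v) (x₁ i)
        ≡⟨ Assemble.extendBy⊥-∉ D (reindex v) (x∈∁p⇒x∉p (P−D.lookup-elems-∈ i))
             (λ _ → cong (lookup v) (P−D.indexOf-lookup _)) ⟩
      lookup v i
        ∎

  count-hasOnlyTop : length (filter hasOnlyTop? (allVecs (allSubsets (suc m)) k)) ≡ d Q₂ * e m Q₁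
  count-hasOnlyTop = begin
    length (filter hasOnlyTop? (allVecs (allSubsets (suc m)) k))
      ≡⟨ length-filter-bijection (vectors (vectors bools (suc m)) k)
           (pairs (vectors bools j₂) (vectors (vectors bools m) j₁)) hasOnlyTop? isCode? encode decode
           (λ {g} → encode-isCode g) (λ {c} → decode-hasOnlyTop c)
           (λ {g} → decode∘encode g) (λ {c} _ → encode∘decode c) ⟩
    length (filter isCode? (cartesianProduct (allSubsets j₂) (allVecs (allSubsets m) j₁)))
      ≡⟨ length-filter-cartesianProduct (isDownset? Q₂) (InF? Q₁ ∘ lookup)
           (allSubsets j₂) (allVecs (allSubsets m) j₁) ⟩
    d Q₂ * countF m Q₁
      ≡⟨ cong (d Q₂ *_) (e≡countF m Q₁ (P−D.induced-isPoset le-poset)) ⟨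
    d Q₂ * e m Q₁
      ∎
    where open ≡-Reasoning

∁-involutive : ∀ {n} (p : Subset n) → ∁ (∁ p) ≡ p
∁-involutive p = trans (sym (mapᵥ-∘ not not p)) (trans (mapᵥ-cong not-involutive p) (mapᵥ-id p))

module _ {k} {le : BRel k} where

  ∁-isUpset : ∀ {D} → IsDownset le D → IsUpset le (∁ D)
  ∁-isUpset D-down x y x≤y x∈ = x∉p⇒x∈∁p (x∈∁p⇒x∉p x∈ ∘ D-down x y x≤y)

  ∁-isDownset : ∀ {U} → IsUpset le U → IsDownset le (∁ U)
  ∁-isDownset U-up x y x≤y y∈ = x∉p⇒x∈∁p (x∈∁p⇒x∉p y∈ ∘ U-up x y x≤y)

module _ {k} (m : ℕ) {le : BRel k} (le-poset : IsPoset le) where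

  e-suc≡sum-downsets : e (suc m) le ≡
    sum (map (λ D → d (induced le (∁ (up le D))) * e m (induced le (∁ D))) (downsets le))
  e-suc≡sum-downsets = begin
    e (suc m) le
      ≡⟨ e≡countF (suc m) le le-poset ⟩
    countF (suc m) le
      ≡⟨ length-filter-partition (vectors bools k) _≟ˢ_ (onlyTop ∘ lookup) (InF? le ∘ lookup) Fs ⟩
    sum (map count (allSubsets k))
      ≡⟨ sum-map-filter (isDownset? le) count (allSubsets k) count-nonDownset ⟩
    sum (map count (downsets le))
      ≡⟨ cong sum (map-cong-local (All.tabulate λ D∈ →
           Decomposition.count-hasOnlyTop m le-poset _ (proj₂ (∈-filter⁻ (isDownset? le) {xs = allSubsets k} D∈)))) ⟩
    sum (map (λ D → d (induced le (∁ (up le D))) * e m (induced le (∁ D))) (downsets le))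
      ∎
    where
    open ≡-Reasoning
    Fs = allVecs (allSubsets (suc m)) k
    count : Subset k → ℕ
    count D = length (filter (λ g → InF? le (lookup g) ×-dec (onlyTop (lookup g) ≟ˢ D)) Fs)
    count-nonDownset : ∀ D → ¬ IsDownset le D → count D ≡ 0
    count-nonDownset D ¬D-down = cong length (filter-none (λ g → InF? le (lookup g) ×-dec (onlyTop (lookup g) ≟ˢ D))
      (All.universal (λ _ (g-InF , onlyTop≡D) → ¬D-down (subst (IsDownset le) onlyTop≡D (onlyTop-isDownset g-InF))) Fs))

  sum-downsets≡sum-upsets :
    sum (map (λ D → d (induced le (∁ (up le D))) * e m (induced le (∁ D))) (downsets le)) ≡
    sum (map (λ U → d (induced le (∁ (up le (∁ U)))) * e m (induced le U)) (upsets le))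
  sum-downsets≡sum-upsets = sum-filter-bijection (vectors bools k) (vectors bools k) (isDownset? le) (isUpset? le)
    ∁ ∁ ∁-isUpset ∁-isDownset (λ {D} _ → ∁-involutive D) (λ {U} _ → ∁-involutive U) _ _
    (λ {D} _ → cong (λ D′ → d (induced le (∁ (up le D′))) * e m (induced le (∁ D))) (sym (∁-involutive D)))

theorem5p2 : (m : ℕ) → 1 ≤ m → (k : ℕ) (le : BRel k) → IsPoset le →
    -- (D,U,f) ↦ f_{m+1} is a bijection F'(M,P) → F({1..m+1},P):
    ((t : Triple m le) → InF le (liftTriple t)) ×
    ((t t' : Triple m le) → (∀ x → liftTriple t x ≡ liftTriple t' x) → SameTriple t t') ×
    ((g : Fin k → Subset (suc m)) → InF le g →
       Σ (Triple m le) (λ t → ∀ x → liftTriple t x ≡ g x)) ×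
    -- counting consequences
    (e (suc m) le ≡ sum (map (λ D → d (induced le (∁ (up le D))) * e m (induced le (∁ D))) (downsets le))) ×
    (e (suc m) le ≡ sum (map (λ U → d (induced le (∁ (up le (∁ U)))) * e m (induced le U)) (upsets le)))
theorem5p2 m _ k le le-poset =
  liftTriple-InF m le-poset ,
  liftTriple-injective m le-poset ,
  liftTriple-surjective m le-poset ,
  e-suc≡sum-downsets m le-poset ,
  trans (e-suc≡sum-downsets m le-poset) (sum-downsets≡sum-upsets m le-poset)
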